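{- Let $n\geq 2$ and $m_1,\dots,m_n\geq 2$ be integers. (i) $pc(K_{m_1}\Box K_{m_2}\Box\cdots\Box K_{m_n})=2$. (ii) $pc(K_{m_1}\circ K_{m_2}\circ\cdots\circ K_{m_n})=1$.
   Context: $K_m$ denotes the complete graph on $m$ vertices. In an edge-colored graph (adjacent edges may receive the same color), a path is a proper path if no two adjacent edges of the path have the same color. The proper connection number $pc(G)$ of a connected graph $G$ is the minimum number of colors in an edge-coloring of $G$ such that every two distinct vertices are joined by a proper path. The Cartesian product $G\Box H$ has vertex set $V(G)\times V(H)$, with $(g,h)\sim(g',h')$ iff ($g=g'$ and $hh'\in E(H)$) or ($h=h'$ and $gg'\in E(G)$). The lexicographic product $G\circ H$ has vertex set $V(G)\times V(H)$, with $(g,h)\sim(g',h')$ iff $gg'\in E(G)$, or ($g=g'$ and $hh'\in E(H)$). -}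

module Defs where

open import Data.Nat using (ℕ; zero; suc; _<_)
open import Data.Fin using (Fin)
open import Data.Vec using (Vec; []; _∷_)
open import Data.List using (List; []; _∷_; _++_; [_])
open import Data.List.Relation.Unary.Unique.Propositional using (Unique)
open import Data.Product using (_×_; _,_; Σ; ∃)
open import Data.Sum using (_⊎_)
open import Relation.Binary.PropositionalEquality using (_≡_; _≢_)
open import Relation.Nullary using (¬_)
open import Data.Unit using (⊤)

record Graph : Set₁ where
  field
    V   : Set
    Adj : V → V → Set
open Graph public

K : ℕ → Graph
K m = record { V = Fin m ; Adj = λ u v → u ≢ v }

_□_ : Graph → Graph → Graph
G □ H = record
  { V   = V G × V H
  ; Adj = λ { (g , h) (g' , h') →
              (g ≡ g' × Adj H h h') ⊎ (h ≡ h' × Adj G g g') } }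

_⊙_ : Graph → Graph → Graph
G ⊙ H = record
  { V   = V G × V H
  ; Adj = λ { (g , h) (g' , h') →
              Adj G g g' ⊎ (g ≡ g' × Adj H h h') } }

cartK : ∀ {n} → Vec ℕ (suc n) → Graph
cartK (m ∷ [])       = K m
cartK (m ∷ m' ∷ ms)  = K m □ cartK (m' ∷ ms)

lexK : ∀ {n} → Vec ℕ (suc n) → Graph
lexK (m ∷ [])       = K m
lexK (m ∷ m' ∷ ms)  = K m ⊙ lexK (m' ∷ ms)

-- An edge-coloring with k colors: a symmetric assignment of a color to
-- each (ordered) pair of vertices; only its values on edges matter.
record EdgeColoring (G : Graph) (k : ℕ) : Set where
  field
    col  : V G → V G → Fin k
    symm : ∀ u v → col u v ≡ col v u
open EdgeColoring public

IsWalk : (G : Graph) → List (V G) → Set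
IsWalk G []             = ⊤
IsWalk G (x ∷ [])       = ⊤
IsWalk G (x ∷ y ∷ rest) = Adj G x y × IsWalk G (y ∷ rest)

ProperColors : {G : Graph} {k : ℕ} → EdgeColoring G k → List (V G) → Set
ProperColors c (x ∷ y ∷ z ∷ rest) = (col c x y ≢ col c y z) × ProperColors c (y ∷ z ∷ rest)
ProperColors c _                  = ⊤

record ProperPath {G : Graph} {k : ℕ} (c : EdgeColoring G k) (u v : V G) : Set where
  field
    mid    : List (V G)
    walk   : IsWalk G (u ∷ mid ++ [ v ])
    simple : Unique (u ∷ mid ++ [ v ])
    proper : ProperColors c (u ∷ mid ++ [ v ])

ProperConnected : {G : Graph} {k : ℕ} → EdgeColoring G k → Set
ProperConnected {G} c = ∀ (u v : V G) → u ≢ v → ProperPath c u v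

PCColorable : Graph → ℕ → Set
PCColorable G k = Σ (EdgeColoring G k) ProperConnected

PCEquals : Graph → ℕ → Set
PCEquals G k = PCColorable G k × (∀ j → j < k → ¬ PCColorable G j)

-- A graph with a Hamiltonian path v₀ v₁ … v_{N-1} has pc ≤ 2: color the edge
-- vᵢvⱼ by the parity of min i j; then the stretch of the Hamiltonian path
-- between any two vertices is a proper path. The product K_{m₁} □ ⋯ □ K_{mₙ}
-- has a Hamiltonian path, traversing the copies of K_{m₂} □ ⋯ □ K_{mₙ} one
-- after another in alternating directions. It is not complete, (0,x) and
-- (1,y) with x ≠ y being non-adjacent, and with a single color a proper path
-- is a single edge; so pc = 2. The lexicographic product of complete graphs
-- is complete, hence pc = 1.
module Submission where

open import Defs
open import Data.Nat using (ℕ; suc; _≤_)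
open import Data.Fin using (Fin)
open import Data.Vec using (Vec; lookup)
open import Data.Product using (_×_)

open import Function using (_∘_)
open import Data.Nat using (zero; _<_; _+_; _∸_; _⊓_; z≤n; s≤s; _<?_)
open import Data.Nat.Properties
open import Data.Fin using (zero; suc; toℕ)
import Data.Fin.Properties as Fin
open import Data.Vec using ([]; _∷_)
open import Data.List using ([]; _∷_; _++_; [_]; applyUpTo)
open import Data.List.Properties using (applyUpTo-∷ʳ)
open import Data.List.Relation.Unary.All using ([]; _∷_)
open import Data.List.Relation.Unary.AllPairs using ([]; _∷_)
open import Data.List.Relation.Unary.Unique.Propositional using (Unique)
open import Data.List.Relation.Unary.Unique.Propositional.Properties using (applyUpTo⁺₁)
open import Data.Product using (Σ; ∃; ∃₂; _,_; proj₁; proj₂)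
open import Data.Sum using (_⊎_; inj₁; inj₂)
open import Data.Empty using (⊥-elim)
open import Data.Unit using (tt)
open import Relation.Nullary using (¬_; yes; no)
open import Relation.Binary.Definitions using (Symmetric; DecidableEquality; tri<; tri≈; tri>)
open import Relation.Binary.PropositionalEquality
  using (_≡_; _≢_; refl; sym; trans; cong; cong₂; subst; subst₂; module ≡-Reasoning)

module _ {G : Graph} where

  WalkOn : (ℕ → V G) → ℕ → Set
  WalkOn f n = ∀ {i} → suc i < n → Adj G (f i) (f (suc i))

  applyUpTo-IsWalk : ∀ f n → WalkOn f n → IsWalk G (applyUpTo f n)
  applyUpTo-IsWalk f zero          _ = tt
  applyUpTo-IsWalk f (suc zero)    _ = tt
  applyUpTo-IsWalk f (suc (suc n)) w =
    w (s≤s (s≤s z≤n)) , applyUpTo-IsWalk (f ∘ suc) (suc n) (w ∘ s≤s)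

  module _ {k : ℕ} (c : EdgeColoring G k) where

    AlternatesOn : (ℕ → V G) → ℕ → Set
    AlternatesOn f n = ∀ {i} → suc (suc i) < n →
      col c (f i) (f (suc i)) ≢ col c (f (suc i)) (f (suc (suc i)))

    applyUpTo-ProperColors : ∀ f n → AlternatesOn f n → ProperColors c (applyUpTo f n)
    applyUpTo-ProperColors f zero                _ = tt
    applyUpTo-ProperColors f (suc zero)          _ = tt
    applyUpTo-ProperColors f (suc (suc zero))    _ = tt
    applyUpTo-ProperColors f (suc (suc (suc n))) a =
      a (s≤s (s≤s (s≤s z≤n))) , applyUpTo-ProperColors (f ∘ suc) (suc (suc n)) (a ∘ s≤s)

    sequence-ProperPath : ∀ f d → WalkOn f (suc (suc d)) →
      (∀ {i j} → i < j → j < suc (suc d) → f i ≢ f j) →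
      AlternatesOn f (suc (suc d)) → ProperPath c (f 0) (f (suc d))
    sequence-ProperPath f d w inj a = record
      { mid    = applyUpTo (f ∘ suc) d
      ; walk   = subst (IsWalk G) shape (applyUpTo-IsWalk f _ w)
      ; simple = subst Unique shape (applyUpTo⁺₁ f _ inj)
      ; proper = subst (ProperColors c) shape (applyUpTo-ProperColors f _ a)
      }
      where
      shape : applyUpTo f (suc (suc d)) ≡ f 0 ∷ applyUpTo (f ∘ suc) d ++ [ f (suc d) ]
      shape = cong (f 0 ∷_) (sym (applyUpTo-∷ʳ (f ∘ suc) d))

∸-suc-< : ∀ {k n} → k < n → n ∸ suc k < n
∸-suc-< {k} {suc n} _ = s≤s (m∸n≤m n k)

∸-suc-involutive : ∀ {k n} → k < n → n ∸ suc (n ∸ suc k) ≡ k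
∸-suc-involutive {n = suc n} (s≤s k≤n) = m∸[m∸n]≡n k≤n

∸-suc-suc : ∀ {k n} → suc k < n → n ∸ suc k ≡ suc (n ∸ suc (suc k))
∸-suc-suc {zero}  {suc zero}    (s≤s ())
∸-suc-suc {zero}  {suc (suc n)} _       = refl
∸-suc-suc {suc k} {suc n}       (s≤s p) = ∸-suc-suc p

-- vertex is total on ℕ; only its values below size form the path.
record HamiltonianPath (G : Graph) : Set where
  field
    size         : ℕ
    vertex       : ℕ → V G
    index        : V G → ℕ
    index<size   : ∀ v → index v < size
    vertex-index : ∀ v → vertex (index v) ≡ v
    index-vertex : ∀ {i} → i < size → index (vertex i) ≡ i
    adjacent     : WalkOn {G} vertex size
open HamiltonianPath

module _ {G : Graph} (H : HamiltonianPath G) where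

  size-positive : 0 < size H
  size-positive = ≤-trans (s≤s z≤n) (index<size H (vertex H 0))

  index-injective : ∀ {u v} → index H u ≡ index H v → u ≡ v
  index-injective {u} {v} e =
    trans (sym (vertex-index H u)) (trans (cong (vertex H) e) (vertex-index H v))

  vertex-injective : ∀ {i j} → i < size H → j < size H → vertex H i ≡ vertex H j → i ≡ j
  vertex-injective p q e = trans (sym (index-vertex H p)) (trans (cong (index H) e) (index-vertex H q))

  module _ {k : ℕ} (c : EdgeColoring G k) (alt : AlternatesOn c (vertex H) (size H)) where

    segment-ProperPath : ∀ {s t} → s < t → t < size H → ProperPath c (vertex H s) (vertex H t)
    segment-ProperPath {s} s<t t<N with m≤n⇒∃[o]m+o≡n s<t
    ... | d , refl =
      subst (ProperPath c (vertex H s) ∘ vertex H) (cong suc (+-comm d s))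
        (sequence-ProperPath c shifted d (adjacent H ∘ bound) distinct (alt ∘ bound))
      where
      shifted : ℕ → V G
      shifted i = vertex H (i + s)
      bound : ∀ {j} → j < suc (suc d) → j + s < size H
      bound j<n = ≤-<-trans (+-monoˡ-≤ s (≤-pred j<n)) (subst (_< size H) (cong suc (+-comm s d)) t<N)
      distinct : ∀ {i j} → i < j → j < suc (suc d) → shifted i ≢ shifted j
      distinct i<j j<n e =
        <⇒≢ (+-monoˡ-< s i<j) (vertex-injective (bound (<-trans i<j j<n)) (bound j<n) e)

module _ {G : Graph} (adj-sym : Symmetric (Adj G)) where

  reverse : HamiltonianPath G → HamiltonianPath G
  reverse H = record
    { size         = N
    ; vertex       = λ i → vertex H (N ∸ suc i)
    ; index        = λ v → N ∸ suc (index H v)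
    ; index<size   = λ v → ∸-suc-< (index<size H v)
    ; vertex-index = λ v → trans (cong (vertex H) (∸-suc-involutive (index<size H v))) (vertex-index H v)
    ; index-vertex = λ p → trans (cong (λ j → N ∸ suc j) (index-vertex H (∸-suc-< p))) (∸-suc-involutive p)
    ; adjacent     = reflected
    }
    where
    N = size H
    reflected : ∀ {i} → suc i < N → Adj G (vertex H (N ∸ suc i)) (vertex H (N ∸ suc (suc i)))
    reflected {i} p rewrite ∸-suc-suc p =
      adj-sym (adjacent H (subst (_< N) (∸-suc-suc p) (∸-suc-< (<⇒≤ p))))

  reverse-alternates : ∀ {k} (c : EdgeColoring G k) (H : HamiltonianPath G) →
    AlternatesOn c (vertex H) (size H) → AlternatesOn c (vertex (reverse H)) (size H)
  -- Positions i, i+1, i+2 of the reversed path are positions j+2, j+1, j of H.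
  reverse-alternates c H alt {i} p
    rewrite ∸-suc-suc (<⇒≤ p) | ∸-suc-suc p = λ e →
      alt q (trans (symm c _ _) (trans (sym e) (symm c _ _)))
    where
    N = size H
    q : suc (suc (N ∸ suc (suc (suc i)))) < N
    q = subst (_< N) (trans (∸-suc-suc (<⇒≤ p)) (cong suc (∸-suc-suc p)))
          (∸-suc-< (<⇒≤ (<⇒≤ p)))

  alternating-hamiltonian⇒ProperConnected : ∀ {k} (c : EdgeColoring G k) (H : HamiltonianPath G) →
    AlternatesOn c (vertex H) (size H) → ProperConnected c
  alternating-hamiltonian⇒ProperConnected c H alt u v u≢v with <-cmp (index H u) (index H v)
  ... | tri< lt _ _ = subst₂ (ProperPath c) (vertex-index H u) (vertex-index H v)
                        (segment-ProperPath H c alt lt (index<size H v))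
  ... | tri≈ _ eq _ = ⊥-elim (u≢v (index-injective H eq))
  ... | tri> _ _ gt = subst₂ (ProperPath c) (vertex-index R u) (vertex-index R v)
                        (segment-ProperPath R c (reverse-alternates c H alt)
                          (∸-monoʳ-< (s≤s gt) (index<size H u)) (index<size R v))
    where
    R = reverse H

parity : ℕ → Fin 2
parity zero          = zero
parity (suc zero)    = suc zero
parity (suc (suc n)) = parity n

parity-suc : ∀ n → parity n ≢ parity (suc n)
parity-suc zero          ()
parity-suc (suc zero)    ()
parity-suc (suc (suc n)) = parity-suc n

module _ {G : Graph} (H : HamiltonianPath G) where

  parityColoring : EdgeColoring G 2
  parityColoring = record
    { col  = λ u v → parity (index H u ⊓ index H v)
    ; symm = λ u v → cong parity (⊓-comm (index H u) (index H v))
    }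

  parityColoring-edge : ∀ {i} → suc i < size H →
    col parityColoring (vertex H i) (vertex H (suc i)) ≡ parity i
  parityColoring-edge {i} p = cong parity (begin
    index H (vertex H i) ⊓ index H (vertex H (suc i)) ≡⟨ cong₂ _⊓_ (index-vertex H (<⇒≤ p)) (index-vertex H p) ⟩
    i ⊓ suc i                                           ≡⟨ m≤n⇒m⊓n≡m (n≤1+n i) ⟩
    i                                                   ∎)
    where open ≡-Reasoning

  parityColoring-alternates : AlternatesOn parityColoring (vertex H) (size H)
  parityColoring-alternates {i} p
    rewrite parityColoring-edge (<⇒≤ p) | parityColoring-edge p = parity-suc i

hamiltonian⇒PCColorable-2 : ∀ {G} → Symmetric (Adj G) → HamiltonianPath G → PCColorable G 2
hamiltonian⇒PCColorable-2 adj-sym H =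
  parityColoring H ,
  alternating-hamiltonian⇒ProperConnected adj-sym (parityColoring H) H (parityColoring-alternates H)

K-symmetric : ∀ {m} → Symmetric (Adj (K m))
K-symmetric u≢v = u≢v ∘ sym

□-symmetric : ∀ {G H} → Symmetric (Adj G) → Symmetric (Adj H) → Symmetric (Adj (G □ H))
□-symmetric G-sym H-sym (inj₁ (g≡g′ , h∼h′)) = inj₁ (sym g≡g′ , H-sym h∼h′)
□-symmetric G-sym H-sym (inj₂ (h≡h′ , g∼g′)) = inj₂ (sym h≡h′ , G-sym g∼g′)

cartK-symmetric : ∀ {n} (ms : Vec ℕ (suc n)) → Symmetric (Adj (cartK ms))
cartK-symmetric (m ∷ [])      = K-symmetric
cartK-symmetric (m ∷ m′ ∷ ms) = □-symmetric K-symmetric (cartK-symmetric (m′ ∷ ms))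

clamp : (k : ℕ) → ℕ → Fin (suc k)
clamp k       zero    = zero
clamp zero    (suc i) = zero
clamp (suc k) (suc i) = suc (clamp k i)

clamp-toℕ : ∀ k (v : Fin (suc k)) → clamp k (toℕ v) ≡ v
clamp-toℕ k       zero    = refl
clamp-toℕ (suc k) (suc v) = cong suc (clamp-toℕ k v)

toℕ-clamp : ∀ k {i} → i < suc k → toℕ (clamp k i) ≡ i
toℕ-clamp k       {zero}  _       = refl
toℕ-clamp (suc k) {suc i} (s≤s p) = cong suc (toℕ-clamp k p)

K-hamiltonian : ∀ k → HamiltonianPath (K (suc k))
K-hamiltonian k = record
  { size         = suc k
  ; vertex       = clamp k
  ; index        = toℕ
  ; index<size   = Fin.toℕ<n
  ; vertex-index = clamp-toℕ k
  ; index-vertex = toℕ-clamp k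
  ; adjacent     = λ {i} p e →
      <⇒≢ (n<1+n i) (trans (sym (toℕ-clamp k (<⇒≤ p))) (trans (cong toℕ e) (toℕ-clamp k p)))
  }

K1□-hamiltonian : ∀ {G} → HamiltonianPath G → HamiltonianPath (K 1 □ G)
K1□-hamiltonian H = record
  { size         = size H
  ; vertex       = λ i → zero , vertex H i
  ; index        = index H ∘ proj₂
  ; index<size   = index<size H ∘ proj₂
  ; vertex-index = λ { (zero , h) → cong (zero ,_) (vertex-index H h) }
  ; index-vertex = index-vertex H
  ; adjacent     = λ p → inj₁ (refl , adjacent H p)
  }

-- The boustrophedon step: traverse the row K 1 □ G along H, then continue
-- with a path P through the remaining rows that starts below the end of H.
module PrependRow {G : Graph} {k : ℕ} (H : HamiltonianPath G) (P : HamiltonianPath (K (suc k) □ G))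
  (P-starts-at-end : proj₂ (vertex P 0) ≡ vertex H (size H ∸ 1)) where

  N = size H

  lift : V (K (suc k) □ G) → V (K (suc (suc k)) □ G)
  lift v = suc (proj₁ v) , proj₂ v

  lift-adjacent : ∀ {u v} → Adj (K (suc k) □ G) u v → Adj (K (suc (suc k)) □ G) (lift u) (lift v)
  lift-adjacent (inj₁ (a≡a′ , h∼h′)) = inj₁ (cong suc a≡a′ , h∼h′)
  lift-adjacent (inj₂ (h≡h′ , a≢a′)) = inj₂ (h≡h′ , a≢a′ ∘ Fin.suc-injective)

  split : ∀ i → i < N ⊎ ∃ λ j → N + j ≡ i
  split i with i <? N
  ... | yes i<N = inj₁ i<N
  ... | no  i≮N = inj₂ (m≤n⇒∃[o]m+o≡n (≮⇒≥ i≮N))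

  vertex′ : ℕ → V (K (suc (suc k)) □ G)
  vertex′ i with i <? N
  ... | yes _ = zero , vertex H i
  ... | no  _ = lift (vertex P (i ∸ N))

  vertex′-< : ∀ {i} → i < N → vertex′ i ≡ (zero , vertex H i)
  vertex′-< {i} i<N with i <? N
  ... | yes _   = refl
  ... | no  i≮N = ⊥-elim (i≮N i<N)

  vertex′-+ : ∀ {i j} → N + j ≡ i → vertex′ i ≡ lift (vertex P j)
  vertex′-+ {j = j} refl with N + j <? N
  ... | yes p = ⊥-elim (m+n≮m N j p)
  ... | no  _ = cong (lift ∘ vertex P) (m+n∸m≡n N j)

  index′ : V (K (suc (suc k)) □ G) → ℕ
  index′ (zero  , h) = index H h
  index′ (suc a , h) = N + index P (a , h)

  index′<size : ∀ v → index′ v < N + size P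
  index′<size (zero  , h) = ≤-trans (index<size H h) (m≤m+n N (size P))
  index′<size (suc a , h) = +-monoʳ-< N (index<size P (a , h))

  vertex′-index′ : ∀ v → vertex′ (index′ v) ≡ v
  vertex′-index′ (zero  , h) = trans (vertex′-< (index<size H h)) (cong (zero ,_) (vertex-index H h))
  vertex′-index′ (suc a , h) = trans (vertex′-+ refl) (cong lift (vertex-index P (a , h)))

  index′-vertex′ : ∀ {i} → i < N + size P → index′ (vertex′ i) ≡ i
  index′-vertex′ {i} p with split i
  ... | inj₁ i<N rewrite vertex′-< i<N = index-vertex H i<N
  ... | inj₂ (j , refl) rewrite vertex′-+ {j = j} refl =
    cong (N +_) (index-vertex P (+-cancelˡ-< N j (size P) p))

  adjacent′ : WalkOn {K (suc (suc k)) □ G} vertex′ (N + size P)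
  adjacent′ {i} p with split (suc i)
  ... | inj₁ si<N =
    subst₂ (Adj (K (suc (suc k)) □ G)) (sym (vertex′-< (<⇒≤ si<N))) (sym (vertex′-< si<N))
      (inj₁ (refl , adjacent H si<N))
  ... | inj₂ (zero , N≡si) =
    subst₂ (Adj (K (suc (suc k)) □ G)) (sym (vertex′-< i<N)) (sym (vertex′-+ N≡si))
      (inj₂ (sym (trans P-starts-at-end (cong (vertex H) N∸1≡i)) , λ ()))
    where
    N≡1+i : N ≡ suc i
    N≡1+i = trans (sym (+-identityʳ N)) N≡si
    i<N : i < N
    i<N = ≤-reflexive (sym N≡1+i)
    N∸1≡i : N ∸ 1 ≡ i
    N∸1≡i = cong (_∸ 1) N≡1+i
  ... | inj₂ (suc j , N+1+j≡1+i) =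
    subst₂ (Adj (K (suc (suc k)) □ G)) (sym (vertex′-+ N+j≡i)) (sym (vertex′-+ N+1+j≡1+i))
      (lift-adjacent (adjacent P (+-cancelˡ-< N (suc j) (size P) (subst (_< N + size P) (sym N+1+j≡1+i) p))))
    where
    N+j≡i : N + j ≡ i
    N+j≡i = suc-injective (trans (sym (+-suc N j)) N+1+j≡1+i)

  path : HamiltonianPath (K (suc (suc k)) □ G)
  path = record
    { size         = N + size P
    ; vertex       = vertex′
    ; index        = index′
    ; index<size   = index′<size
    ; vertex-index = vertex′-index′
    ; index-vertex = index′-vertex′
    ; adjacent     = adjacent′
    }

  path-starts-at-start : proj₂ (vertex path 0) ≡ vertex H 0
  path-starts-at-start = cong proj₂ (vertex′-< (size-positive H))

K□-hamiltonian : ∀ {G} k → Symmetric (Adj G) → (H : HamiltonianPath G) →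
  Σ (HamiltonianPath (K (suc k) □ G)) λ P → proj₂ (vertex P 0) ≡ vertex H 0
K□-hamiltonian zero    _       H = K1□-hamiltonian H , refl
K□-hamiltonian (suc k) adj-sym H with K□-hamiltonian k adj-sym (reverse adj-sym H)
... | P , P-starts = PrependRow.path H P P-starts , PrependRow.path-starts-at-start H P P-starts

cartK-hamiltonian : ∀ {n} (ms : Vec ℕ (suc n)) → (∀ i → 0 < lookup ms i) → HamiltonianPath (cartK ms)
cartK-hamiltonian (zero  ∷ [])      nonempty with nonempty zero
... | ()
cartK-hamiltonian (suc m ∷ [])      _        = K-hamiltonian m
cartK-hamiltonian (zero  ∷ _ ∷ _)   nonempty with nonempty zero
... | ()
cartK-hamiltonian (suc m ∷ m′ ∷ ms) nonempty =
  proj₁ (K□-hamiltonian m (cartK-symmetric (m′ ∷ ms)) (cartK-hamiltonian (m′ ∷ ms) (nonempty ∘ suc)))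

¬PCColorable-0 : ∀ {G} → V G → ¬ PCColorable G 0
¬PCColorable-0 x (c , _) with col c x x
... | ()

Fin1-irrelevant : (a b : Fin 1) → a ≡ b
Fin1-irrelevant zero zero = refl

monochromatic-ProperPath⇒Adj : ∀ {G} {u v} (c : EdgeColoring G 1) → ProperPath c u v → Adj G u v
monochromatic-ProperPath⇒Adj c record { mid = []        ; walk   = u∼v , _ } = u∼v
monochromatic-ProperPath⇒Adj c record { mid = _ ∷ []     ; proper = c≢c , _ } = ⊥-elim (c≢c (Fin1-irrelevant _ _))
monochromatic-ProperPath⇒Adj c record { mid = _ ∷ _ ∷ _ ; proper = c≢c , _ } = ⊥-elim (c≢c (Fin1-irrelevant _ _))

¬PCColorable-1 : ∀ {G} {u v : V G} → u ≢ v → ¬ Adj G u v → ¬ PCColorable G 1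
¬PCColorable-1 u≢v u≁v (c , connected) = u≁v (monochromatic-ProperPath⇒Adj c (connected _ _ u≢v))

K□-¬PCColorable-1 : ∀ {G} m {x y : V G} → x ≢ y → ¬ PCColorable (K (suc (suc m)) □ G) 1
K□-¬PCColorable-1 {G} m {x} {y} x≢y = ¬PCColorable-1 (λ ()) nonadjacent
  where
  nonadjacent : ¬ Adj (K (suc (suc m)) □ G) (zero , x) (suc zero , y)
  nonadjacent (inj₁ (() , _))
  nonadjacent (inj₂ (x≡y , _)) = x≢y x≡y

cartK-distinct : ∀ {n} (ms : Vec ℕ (suc n)) → (∀ i → 2 ≤ lookup ms i) →
  ∃₂ λ (x y : V (cartK ms)) → x ≢ y
cartK-distinct (zero ∷ _)         large with large zero
... | ()
cartK-distinct (suc zero ∷ [])    large with large zero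
... | s≤s ()
cartK-distinct (suc (suc m) ∷ []) _     = zero , suc zero , λ ()
cartK-distinct (suc m ∷ m′ ∷ ms)  large with cartK-distinct (m′ ∷ ms) (large ∘ suc)
... | x , y , x≢y = (zero , x) , (zero , y) , x≢y ∘ cong proj₂

cartK-¬PCColorable-1 : ∀ {n} (ms : Vec ℕ (suc (suc n))) → (∀ i → 2 ≤ lookup ms i) →
  ¬ PCColorable (cartK ms) 1
cartK-¬PCColorable-1 (zero ∷ _)        large with large zero
... | ()
cartK-¬PCColorable-1 (suc zero ∷ _)    large with large zero
... | s≤s ()
cartK-¬PCColorable-1 (suc (suc m) ∷ m′ ∷ ms) large with cartK-distinct (m′ ∷ ms) (large ∘ suc)
... | _ , _ , x≢y = K□-¬PCColorable-1 m x≢y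

Complete : Graph → Set
Complete G = ∀ {u v} → u ≢ v → Adj G u v

complete⇒PCColorable-1 : ∀ {G} → Complete G → PCColorable G 1
complete⇒PCColorable-1 complete = monochromatic , λ u v u≢v → record
  { mid = [] ; walk = complete u≢v , tt ; simple = (u≢v ∷ []) ∷ [] ∷ [] ; proper = tt }
  where
  monochromatic : EdgeColoring _ 1
  monochromatic = record { col = λ _ _ → zero ; symm = λ _ _ → refl }

⊙-complete : ∀ {G H} → DecidableEquality (V G) → Complete G → Complete H → Complete (G ⊙ H)
⊙-complete _≟_ G-complete H-complete {g , h} {g′ , h′} ne with g ≟ g′
... | yes refl = inj₂ (refl , H-complete (ne ∘ cong (g ,_)))
... | no  g≢g′ = inj₁ (G-complete g≢g′)

lexK-complete : ∀ {n} (ms : Vec ℕ (suc n)) → Complete (lexK ms)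
lexK-complete (m ∷ [])      = λ u≢v → u≢v
lexK-complete (m ∷ m′ ∷ ms) = ⊙-complete Fin._≟_ (λ u≢v → u≢v) (lexK-complete (m′ ∷ ms))

lexK-vertex : ∀ {n} (ms : Vec ℕ (suc n)) → (∀ i → 0 < lookup ms i) → V (lexK ms)
lexK-vertex (zero ∷ _)        nonempty with nonempty zero
... | ()
lexK-vertex (suc m ∷ [])      _        = zero
lexK-vertex (suc m ∷ m′ ∷ ms) nonempty = zero , lexK-vertex (m′ ∷ ms) (nonempty ∘ suc)

proposition6 : (n : ℕ) → (ms : Vec ℕ (suc (suc n))) →
    (∀ i → 2 ≤ lookup ms i) →
    PCEquals (cartK ms) 2 × PCEquals (lexK ms) 1
proposition6 n ms large =
  (hamiltonian⇒PCColorable-2 (cartK-symmetric ms) (cartK-hamiltonian ms nonempty) , cartK-fewer) ,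
  (complete⇒PCColorable-1 (lexK-complete ms) , lexK-fewer)
  where
  nonempty : ∀ i → 0 < lookup ms i
  nonempty i = ≤-trans (s≤s z≤n) (large i)
  cartK-fewer : ∀ j → j < 2 → ¬ PCColorable (cartK ms) j
  cartK-fewer zero          _ = ¬PCColorable-0 (proj₁ (cartK-distinct ms large))
  cartK-fewer (suc zero)    _ = cartK-¬PCColorable-1 ms large
  cartK-fewer (suc (suc j)) (s≤s (s≤s ()))
  lexK-fewer : ∀ j → j < 1 → ¬ PCColorable (lexK ms) j
  lexK-fewer zero    _ = ¬PCColorable-0 (lexK-vertex ms nonempty)
  lexK-fewer (suc j) (s≤s ())
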